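{- If $G$ is an EOCD graph with empty $D\cap P$, then $\gamma_t(G)=\gamma(G)$.
   Context: Graphs are finite and simple. $\gamma(G)$ is the domination number (minimum size of $S\subseteq V(G)$ such that every vertex outside $S$ has a neighbor in $S$) and $\gamma_t(G)$ is the total domination number (minimum size of $S$ such that every vertex of $G$ has a neighbor in $S$). A set $P$ is an ECD set if the closed neighborhoods $N[v]$, $v\in P$, partition $V(G)$; a set $D$ is an EOD set if the open neighborhoods $N(v)$, $v\in D$, partition $V(G)$. $G$ is an EOCD graph with empty $D\cap P$ if there exist an ECD set $P$ and an EOD set $D$ of $G$ with $D\cap P=\emptyset$. -}

module Defs where

open import Data.Nat using (ℕ; _≤_)
open import Data.Fin using (Fin)
open import Data.Fin.Subset using (Subset; _∈_; ∣_∣)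
open import Data.Bool using (Bool; true; false)
open import Data.Product using (Σ; ∃; _×_; _,_)
open import Data.Sum using (_⊎_)
open import Relation.Binary.PropositionalEquality using (_≡_)
open import Relation.Nullary using (¬_)

record Graph (n : ℕ) : Set where
  field
    adj   : Fin n → Fin n → Bool
    sym   : ∀ u v → adj u v ≡ adj v u
    irrefl : ∀ v → adj v v ≡ false
open Graph public

module _ {n : ℕ} (G : Graph n) where

  Adj : Fin n → Fin n → Set
  Adj u v = adj G u v ≡ true

  InOpenNbhd : Fin n → Fin n → Set
  InOpenNbhd u v = Adj u v

  InClosedNbhd : Fin n → Fin n → Set
  InClosedNbhd u v = (u ≡ v) ⊎ Adj u v

  IsDominating : Subset n → Set
  IsDominating S = ∀ u → ¬ (u ∈ S) → ∃ λ v → v ∈ S × Adj u v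

  IsTotalDominating : Subset n → Set
  IsTotalDominating S = ∀ u → ∃ λ v → v ∈ S × Adj u v

  IsDominationNumber : ℕ → Set
  IsDominationNumber k =
    (∃ λ S → IsDominating S × ∣ S ∣ ≡ k) × (∀ S → IsDominating S → k ≤ ∣ S ∣)

  IsTotalDominationNumber : ℕ → Set
  IsTotalDominationNumber k =
    (∃ λ S → IsTotalDominating S × ∣ S ∣ ≡ k) × (∀ S → IsTotalDominating S → k ≤ ∣ S ∣)

  IsECD : Subset n → Set
  IsECD P =
    (∀ u → ∃ λ v → v ∈ P × InClosedNbhd u v) ×
    (∀ u v w → v ∈ P → w ∈ P → InClosedNbhd u v → InClosedNbhd u w → v ≡ w)

  IsEOD : Subset n → Set
  IsEOD D =
    (∀ u → ∃ λ v → v ∈ D × InOpenNbhd u v) ×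
    (∀ u v w → v ∈ D → w ∈ D → InOpenNbhd u v → InOpenNbhd u w → v ≡ w)

  IsEOCDDisjoint : Set
  IsEOCDDisjoint =
    ∃ λ P → ∃ λ D → IsECD P × IsEOD D × (∀ v → v ∈ D → ¬ (v ∈ P))

module Submission where

-- Let P be an ECD set and D an EOD set with D ∩ P = ∅.
-- Every bound in the argument is one counting principle: if each element
-- of A has a witness in B, and no element of B witnesses two distinct
-- elements of A, then ∣A∣ ≤ ∣B∣ (witness-count).  Applied to the
-- partitions given by P and D it yields
--   * ∣P∣ ≤ ∣S∣ for every dominating S  (S meets every N[p], N[p] disjoint),
--   * ∣D∣ ≤ ∣T∣ for every set T meeting every N(d), d ∈ D
--     (in particular every total dominating T).
-- Since P is dominating and D is total dominating, γ(G) = ∣P∣ and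
-- γ_t(G) = ∣D∣ (minimum-size-char).  Finally ∣P∣ = ∣D∣: D is dominating,
-- so ∣P∣ ≤ ∣D∣; and as D ∩ P = ∅, every d ∈ D has its P-vertex in N(d),
-- so ∣D∣ ≤ ∣P∣.  Hence γ(G) = ∣P∣ = ∣D∣ = γ_t(G).

open import Defs
open import Data.Nat using (ℕ; suc; _≤_; z≤n; s≤s)
open import Data.Nat.Properties using (≤-antisym; ≤-trans; ≤-reflexive; module ≤-Reasoning)
open import Data.Fin using (Fin; zero; suc)
open import Data.Fin.Properties using (suc-injective)
open import Data.Fin.Subset using (Subset; _∈_; ∣_∣; _-_; inside; outside)
open import Data.Fin.Subset.Properties using (_∈?_; x∈p∧x≢y⇒x∈p-y; x∈p⇒∣p-x∣<∣p∣)
open import Data.Vec.Base using (here; there; _∷_; [])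
open import Data.Product using (∃; _×_; _,_)
open import Data.Sum using (inj₁; inj₂)
open import Data.Empty using (⊥-elim)
open import Function.Bundles using (_⇔_; mk⇔; Equivalence)
open import Relation.Nullary using (¬_; yes; no)
open import Relation.Binary.PropositionalEquality using (_≡_; refl; trans; subst) renaming (sym to ≡-sym)

-- Each element of A consumes its witness, which is removed from B.
witness-count : ∀ {n m} (A : Subset n) (B : Subset m) (R : Fin m → Fin n → Set) →
  (∀ a → a ∈ A → ∃ λ b → b ∈ B × R b a) →
  (∀ {a a′ b} → a ∈ A → a′ ∈ A → R b a → R b a′ → a ≡ a′) →
  ∣ A ∣ ≤ ∣ B ∣
witness-count [] B R witness unique = z≤n
witness-count (outside ∷ A) B R witness unique =
  witness-count A B (λ b a → R b (suc a))
    (λ a a∈A → witness (suc a) (there a∈A))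
    (λ a∈A a′∈A r r′ → suc-injective (unique (there a∈A) (there a′∈A) r r′))
witness-count (inside ∷ A) B R witness unique with witness zero here
... | b , b∈B , b-witnesses-zero = begin
    suc ∣ A ∣     ≤⟨ s≤s rest ⟩
    suc ∣ B - b ∣ ≤⟨ x∈p⇒∣p-x∣<∣p∣ b∈B ⟩
    ∣ B ∣         ∎
  where
  open ≤-Reasoning
  witness-without-b : ∀ a → a ∈ A → ∃ λ b′ → b′ ∈ B - b × R b′ (suc a)
  witness-without-b a a∈A with witness (suc a) (there a∈A)
  ... | b′ , b′∈B , r = b′ , x∈p∧x≢y⇒x∈p-y b′∈B b′≢b , r
    where
    b′≢b : ¬ (b′ ≡ b)
    b′≢b refl with unique here (there a∈A) b-witnesses-zero r
    ... | ()
  rest : ∣ A ∣ ≤ ∣ B - b ∣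
  rest = witness-count A (B - b) (λ b′ a → R b′ (suc a)) witness-without-b
    (λ a∈A a′∈A r r′ → suc-injective (unique (there a∈A) (there a′∈A) r r′))

MinimumSize : ∀ {n} → (Subset n → Set) → ℕ → Set
MinimumSize Q k = (∃ λ S → Q S × ∣ S ∣ ≡ k) × (∀ S → Q S → k ≤ ∣ S ∣)

minimum-size-char : ∀ {n} {Q : Subset n → Set} {X : Subset n} →
  Q X → (∀ S → Q S → ∣ X ∣ ≤ ∣ S ∣) → ∀ k → MinimumSize Q k ⇔ k ≡ ∣ X ∣
minimum-size-char {Q = Q} {X = X} QX X-smallest k = mk⇔ is-size-of-X attained
  where
  is-size-of-X : MinimumSize Q k → k ≡ ∣ X ∣
  is-size-of-X ((S , QS , ∣S∣≡k) , minimal) =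
    ≤-antisym (minimal X QX) (≤-trans (X-smallest S QS) (≤-reflexive ∣S∣≡k))
  attained : k ≡ ∣ X ∣ → MinimumSize Q k
  attained refl = (X , QX , refl) , X-smallest

module _ {n : ℕ} (G : Graph n) where

  adj-sym : ∀ {u v} → Adj G u v → Adj G v u
  adj-sym {u} {v} = trans (Graph.sym G v u)

  -- If P is ECD and S meets every N[p], p ∈ P, then ∣P∣ ≤ ∣S∣:
  -- the sets N[p] are pairwise disjoint.
  ecd-bound : ∀ {P S} → IsECD G P →
    (∀ p → p ∈ P → ∃ λ s → s ∈ S × InClosedNbhd G s p) → ∣ P ∣ ≤ ∣ S ∣
  ecd-bound {P} {S} (_ , disjoint) meets =
    witness-count P S (InClosedNbhd G) meets (λ {_} {_} {s} → disjoint s _ _)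

  -- If D is EOD and T meets every N(d), d ∈ D, then ∣D∣ ≤ ∣T∣:
  -- the sets N(d) are pairwise disjoint.
  eod-bound : ∀ {D T} → IsEOD G D →
    (∀ d → d ∈ D → ∃ λ t → t ∈ T × Adj G d t) → ∣ D ∣ ≤ ∣ T ∣
  eod-bound {D} {T} (_ , disjoint) meets =
    witness-count D T (InOpenNbhd G) witness (λ {_} {_} {t} → disjoint t _ _)
    where
    witness : ∀ d → d ∈ D → ∃ λ t → t ∈ T × Adj G t d
    witness d d∈D with meets d d∈D
    ... | t , t∈T , d~t = t , t∈T , adj-sym d~t

  dominating-meets-closed-nbhd : ∀ {S} → IsDominating G S →
    ∀ v → ∃ λ s → s ∈ S × InClosedNbhd G s v
  dominating-meets-closed-nbhd {S} dominating v with v ∈? S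
  ... | yes v∈S = v , v∈S , inj₁ refl
  ... | no  v∉S with dominating v v∉S
  ...   | s , s∈S , v~s = s , s∈S , inj₂ (adj-sym v~s)

  total⇒dominating : ∀ {S} → IsTotalDominating G S → IsDominating G S
  total⇒dominating total u _ = total u

  -- An ECD set dominates: a vertex outside P lies in N(p) for the p ∈ P
  -- whose closed neighbourhood contains it.
  ecd⇒dominating : ∀ {P} → IsECD G P → IsDominating G P
  ecd⇒dominating {P} (covers , _) u u∉P with covers u
  ... | p , p∈P , inj₁ u≡p = ⊥-elim (u∉P (subst (_∈ P) (≡-sym u≡p) p∈P))
  ... | p , p∈P , inj₂ u~p = p , p∈P , u~p

  γ-via-ECD : ∀ {P} → IsECD G P → ∀ k → IsDominationNumber G k ⇔ k ≡ ∣ P ∣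
  γ-via-ECD ecd = minimum-size-char (ecd⇒dominating ecd)
    (λ S dominating → ecd-bound ecd (λ p _ → dominating-meets-closed-nbhd dominating p))

  -- An EOD set has size γ_t(G); its covering property is total domination.
  γt-via-EOD : ∀ {D} → IsEOD G D → ∀ k → IsTotalDominationNumber G k ⇔ k ≡ ∣ D ∣
  γt-via-EOD eod@(covers , _) = minimum-size-char covers
    (λ T total → eod-bound eod (λ d _ → total d))

  -- Disjoint ECD and EOD sets have the same size: D dominates, and since
  -- no d ∈ D lies in P, P dominates d through a vertex of N(d).
  ecd-eod-same-size : ∀ {P D} → IsECD G P → IsEOD G D →
    (∀ v → v ∈ D → ¬ (v ∈ P)) → ∣ P ∣ ≡ ∣ D ∣
  ecd-eod-same-size ecd eod@(covers , _) disjoint = ≤-antisym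
    (ecd-bound ecd (λ p _ → dominating-meets-closed-nbhd (total⇒dominating covers) p))
    (eod-bound eod (λ d d∈D → ecd⇒dominating ecd d (disjoint d d∈D)))

proposition2p3 : ∀ {n : ℕ} (G : Graph n) → IsEOCDDisjoint G →
    ∀ (k : ℕ) → (IsDominationNumber G k → IsTotalDominationNumber G k) ×
                 (IsTotalDominationNumber G k → IsDominationNumber G k)
proposition2p3 G (P , D , ecd , eod , disjoint) k =
    (λ γ≡k  → from γt⇔ (trans (to γ⇔ γ≡k) ∣P∣≡∣D∣))
  , (λ γt≡k → from γ⇔ (trans (to γt⇔ γt≡k) (≡-sym ∣P∣≡∣D∣)))
  where
  open Equivalence
  γ⇔ : IsDominationNumber G k ⇔ k ≡ ∣ P ∣
  γ⇔ = γ-via-ECD G ecd k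
  γt⇔ : IsTotalDominationNumber G k ⇔ k ≡ ∣ D ∣
  γt⇔ = γt-via-EOD G eod k
  ∣P∣≡∣D∣ : ∣ P ∣ ≡ ∣ D ∣
  ∣P∣≡∣D∣ = ecd-eod-same-size G ecd eod disjoint
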